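{- Let $D=(V,A)$ be a minimal strong digraph and let $u,w\in V$ be vertices with $uw\notin A$ (here $u\neq w$, since digraphs have no loops). Let $v\notin V$ and let $e_{uw}(D)=(V\cup\{v\},\,A\cup\{uv,vw\})$ be the external expansion of $D$ by $v$ from $u$ to $w$. Then $e_{uw}(D)$ is a minimal strong digraph if and only if the digraph $D+uw=(V,A\cup\{uw\})$ has no transitive arcs other than $uw$.
   Context: A digraph is a pair $D=(V,A)$ with $V$ a finite nonempty set and $A\subseteq V\times V\setminus\{(x,x):x\in V\}$; the arc $(x,y)$ is written $xy$. $D+xy$ denotes $(V,A\cup\{xy\})$ and $D-xy$ denotes $(V,A\setminus\{xy\})$. A digraph is strong (strongly connected) if for every ordered pair of vertices $x,y$ there is a directed path from $x$ to $y$. A strong digraph $D$ is minimal strong if $D-a$ is not strong for every arc $a\in A$. An arc $xy$ of a digraph is transitive if there is a directed $x$–$y$ path in the digraph other than the arc $xy$ itself. -}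

module Defs where

open import Data.Nat using (ℕ; suc; _≤_)
open import Data.Fin using (Fin; inject₁; fromℕ)
open import Data.List using (List; []; _∷_; length)
open import Data.List.Relation.Unary.Unique.Propositional using (Unique)
open import Data.Product using (_×_; ∃-syntax; _,_)
open import Data.Sum using (_⊎_)
open import Relation.Nullary using (¬_)
open import Relation.Binary.PropositionalEquality using (_≡_)

ArcRel : ℕ → Set₁
ArcRel n = Fin n → Fin n → Set

Loopless : ∀ {n} → ArcRel n → Set
Loopless A = ∀ x → ¬ A x x

addArc : ∀ {n} → ArcRel n → Fin n → Fin n → ArcRel n
addArc A x y a b = A a b ⊎ ((a ≡ x) × (b ≡ y))

delArc : ∀ {n} → ArcRel n → Fin n → Fin n → ArcRel n
delArc A x y a b = A a b × ¬ ((a ≡ x) × (b ≡ y))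

data Walk {n} (A : ArcRel n) : List (Fin n) → Fin n → Fin n → Set where
  here : ∀ x → Walk A (x ∷ []) x x
  step : ∀ {x y z vs} → A x y → Walk A vs y z → Walk A (x ∷ vs) x z

Path : ∀ {n} → ArcRel n → Fin n → Fin n → List (Fin n) → Set
Path A x y vs = Walk A vs x y × Unique vs

Strong : ∀ {n} → ArcRel n → Set
Strong A = ∀ x y → ∃[ vs ] Path A x y vs

MinimalStrong : ∀ {n} → ArcRel n → Set
MinimalStrong A = Loopless A × Strong A
                × (∀ x y → A x y → ¬ Strong (delArc A x y))

-- The arc xy of A is transitive if there is a directed x–y path other than
-- the arc xy itself, i.e. a path with at least 3 vertices.
Transitive : ∀ {n} → ArcRel n → Fin n → Fin n → Set
Transitive A x y = A x y × ∃[ vs ] (Path A x y vs × 3 ≤ length vs)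

data Expand {n} (A : ArcRel n) (u w : Fin n) : ArcRel (suc n) where
  old : ∀ {x y} → A x y → Expand A u w (inject₁ x) (inject₁ y)
  uv  : Expand A u w (inject₁ u) (fromℕ n)
  vw  : Expand A u w (fromℕ n) (inject₁ w)

module Submission where

-- Write  E = e_uw(D),  v  for the new vertex and  D+ = D + uw.  The proof
-- rests on one general observation: in a strong digraph R an arc xy can be
-- deleted without losing strong connectivity iff R − xy still has an x–y
-- walk (a "bypass"), and for x ≢ y this happens iff xy is transitive.
--
-- For the expansion we show that E is loopless and strong, that the arcs
-- uv and vw can never be deleted (they are the only arcs into/out of v),
-- and that for an arc xy of D a bypass of ιx ιy in E corresponds exactly
-- to a bypass of xy in D+ (the detour u v w in E plays the role of the
-- arc uw in D+).

open import Defs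
open import Data.Nat using (ℕ; suc; _≤_; s≤s; z≤n)
open import Data.Fin using (Fin; inject₁; fromℕ; _≟_)
open import Data.Fin.Properties using (fromℕ≢inject₁; inject₁-injective)
open import Data.Fin.Relation.Unary.Top using (view; ‵fromℕ; ‵inject₁)
open import Data.Product using (_×_; _,_; proj₁; proj₂; ∃-syntax)
open import Data.Sum using (inj₁; inj₂)
open import Data.Empty using (⊥-elim)
open import Data.List using (List; []; _∷_; length)
open import Data.List.Relation.Unary.Any using (here; there; any?)
open import Data.List.Relation.Unary.All using (All; []; _∷_)
import Data.List.Relation.Unary.All as All
open import Data.List.Relation.Unary.AllPairs using ([]; _∷_)
open import Data.List.Relation.Unary.All.Properties.Core using (¬Any⇒All¬)
open import Data.List.Membership.Propositional using (_∈_)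
open import Data.List.Relation.Unary.Unique.Propositional using (Unique)
open import Relation.Nullary using (¬_; yes; no)
open import Relation.Binary.PropositionalEquality
  using (_≡_; _≢_; refl; sym; trans; cong)
open import Function using (id)
open import Function.Bundles using (_⇔_; mk⇔)

private
  variable
    m k : ℕ

Reach : ArcRel m → Fin m → Fin m → Set
Reach R a b = ∃[ vs ] Walk R vs a b

strong⇒reach : {R : ArcRel m} → Strong R → ∀ a b → Reach R a b
strong⇒reach strong a b with strong a b
... | vs , walk , _ = vs , walk

reach-trans : {R : ArcRel m} {vs : List (Fin m)} {a b c : Fin m} →
  Walk R vs a b → Reach R b c → Reach R a c
reach-trans (here _)   q = q
reach-trans (step r p) q with reach-trans p q
... | _ , pq = _ , step r pq

walk-map : {R S : ArcRel m} → (∀ {a b} → R a b → S a b) →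
  ∀ {vs a b} → Walk R vs a b → Walk S vs a b
walk-map f (here x)   = here x
walk-map f (step r p) = step (f r) (walk-map f p)

reach-refine : {R : ArcRel m} {S : ArcRel k} (f : Fin m → Fin k) →
  (∀ {a c} → R a c → Reach S (f a) (f c)) →
  ∀ {vs a b} → Walk R vs a b → Reach S (f a) (f b)
reach-refine f simulate (here _)   = _ , here _
reach-refine f simulate (step r p) =
  reach-trans (proj₂ (simulate r)) (reach-refine f simulate p)

walk-end∈ : {R : ArcRel m} {vs : List (Fin m)} {a b : Fin m} →
  Walk R vs a b → b ∈ vs
walk-end∈ (here _)   = here refl
walk-end∈ (step _ p) = there (walk-end∈ p)

path-suffix : {R : ArcRel m} {vs : List (Fin m)} {a b c : Fin m} →
  Walk R vs a b → Unique vs → c ∈ vs → ∃[ ws ] Path R c b ws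
path-suffix p@(here _)   distinct       (here refl)  = _ , p , distinct
path-suffix p@(step _ _) distinct       (here refl)  = _ , p , distinct
path-suffix (step _ p)   (_ ∷ distinct) (there c∈vs) = path-suffix p distinct c∈vs

walk⇒path : {R : ArcRel m} {vs : List (Fin m)} {a b : Fin m} →
  Walk R vs a b → ∃[ ws ] Path R a b ws
walk⇒path (here x) = _ , here x , [] ∷ []
walk⇒path (step {x} r p) with walk⇒path p
... | ws , q , distinct with any? (x ≟_) ws
...   | yes x∈ws = path-suffix q distinct x∈ws
...   | no  x∉ws = x ∷ ws , step r q , ¬Any⇒All¬ ws x∉ws ∷ distinct

arc-out-of : {R : ArcRel m} {vs : List (Fin m)} {a b : Fin m} →
  Walk R vs a b → a ≢ b → ∃[ c ] R a c
arc-out-of (here _)   a≢b = ⊥-elim (a≢b refl)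
arc-out-of (step r _) _   = _ , r

arc-into : {R : ArcRel m} {vs : List (Fin m)} {a b : Fin m} →
  Walk R vs a b → a ≢ b → ∃[ c ] R c b
arc-into (here _) a≢b = ⊥-elim (a≢b refl)
arc-into (step {x} {y} {z} r p) _ with y ≟ z
... | yes refl = x , r
... | no  y≢z  = arc-into p y≢z

three≤length : {R : ArcRel m} {vs : List (Fin m)} {a b : Fin m} →
  Walk R vs a b → a ≢ b → ¬ R a b → 3 ≤ length vs
three≤length (here _)                     a≢b _    = ⊥-elim (a≢b refl)
three≤length (step r (here _))            _   ¬Rab = ⊥-elim (¬Rab r)
three≤length (step _ (step _ (here _)))   _   _    = s≤s (s≤s (s≤s z≤n))
three≤length (step _ (step _ (step _ _))) _   _    = s≤s (s≤s (s≤s z≤n))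

walk-avoiding : {R : ArcRel m} {x y : Fin m} {vs : List (Fin m)} {a b : Fin m} →
  Walk R vs a b → All (x ≢_) vs → Walk (delArc R x y) vs a b
walk-avoiding (here a)   _          = here a
walk-avoiding (step r p) (x≢a ∷ xs) =
  step (r , λ { (a≡x , _) → x≢a (sym a≡x) }) (walk-avoiding p xs)

-- A transitive arc xy has a bypass: its long x–y path avoids the arc xy.
transitive⇒bypass : {R : ArcRel m} {x y : Fin m} →
  Transitive R x y → Reach (delArc R x y) x y
transitive⇒bypass (_ , _ , (here _ , _) , s≤s ())
transitive⇒bypass (_ , _ , (step _ (here _) , _) , s≤s (s≤s ()))
transitive⇒bypass {x = x} {y = y}
  (_ , _ , (step {y = z} Rxz rest@(step _ tail) , x∉ ∷ z∉ ∷ _) , _) =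
  _ , step (Rxz , z≢y) (walk-avoiding rest x∉)
  where
  z≢y : ¬ (x ≡ x × z ≡ y)
  z≢y (_ , z≡y) = All.lookup z∉ (walk-end∈ tail) z≡y

bypass⇒transitive : {R : ArcRel m} {x y : Fin m} →
  R x y → x ≢ y → Reach (delArc R x y) x y → Transitive R x y
bypass⇒transitive Rxy x≢y (_ , bypass) with walk⇒path bypass
... | vs , p , distinct =
  Rxy , vs , (walk-map proj₁ p , distinct) ,
  three≤length p x≢y (λ { (_ , not-xy) → not-xy (refl , refl) })

-- In a strong digraph, deleting an arc that has a bypass keeps it strong:
-- every use of the arc in a walk is replaced by the bypass.
bypass⇒strong : {R : ArcRel m} {x y : Fin m} →
  Strong R → Reach (delArc R x y) x y → Strong (delArc R x y)
bypass⇒strong {R = R} {x} {y} strong bypass a b =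
  walk⇒path (proj₂ (reach-refine id reroute (proj₂ (strong⇒reach strong a b))))
  where
  reroute : ∀ {c d} → R c d → Reach (delArc R x y) c d
  reroute {c} {d} r with c ≟ x | d ≟ y
  ... | yes refl | yes refl = bypass
  ... | no  c≢x  | _        = _ , step (r , λ { (c≡x , _) → c≢x c≡x }) (here d)
  ... | yes _    | no  d≢y  = _ , step (r , λ { (_ , d≡y) → d≢y d≡y }) (here d)

module Expansion {n : ℕ} (A : ArcRel n) (u w : Fin n) where
  E : ArcRel (suc n)
  E = Expand A u w

  v : Fin (suc n)
  v = fromℕ n

  ι : Fin n → Fin (suc n)
  ι = inject₁

  D+ : ArcRel n
  D+ = addArc A u w

  v≢ι : ∀ {x} → v ≢ ι x
  v≢ι = fromℕ≢inject₁

  into-v : ∀ {p q} → E p q → q ≡ v → p ≡ ι u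
  into-v (old _) q≡v = ⊥-elim (v≢ι (sym q≡v))
  into-v uv      _   = refl
  into-v vw      q≡v = ⊥-elim (v≢ι (sym q≡v))

  out-of-v : ∀ {p q} → E p q → p ≡ v → q ≡ ι w
  out-of-v (old _) p≡v = ⊥-elim (v≢ι (sym p≡v))
  out-of-v uv      p≡v = ⊥-elim (v≢ι (sym p≡v))
  out-of-v vw      _   = refl

  expand-irreflexive : Loopless A → ∀ {a b} → E a b → a ≢ b
  expand-irreflexive loopless (old {x} Axy) ιx≡ιy with inject₁-injective ιx≡ιy
  ... | refl = loopless x Axy
  expand-irreflexive loopless uv ιu≡v = v≢ι (sym ιu≡v)
  expand-irreflexive loopless vw v≡ιw = v≢ι v≡ιw

  -- E is strong when D is: walks of D lift via ι, and v is entered from u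
  -- and left towards w.
  expand-strong : Strong A → Strong E
  expand-strong strong p q = walk⇒path (proj₂ (reach p q))
    where
    lift : ∀ a b → Reach E (ι a) (ι b)
    lift a b = reach-refine ι (λ Acd → _ , step (old Acd) (here _))
                 (proj₂ (strong⇒reach strong a b))
    reach : ∀ p q → Reach E p q
    reach p q with view p | view q
    ... | ‵fromℕ     | ‵fromℕ     = _ , here v
    ... | ‵fromℕ     | ‵inject₁ b = reach-trans (step vw (here _)) (lift w b)
    ... | ‵inject₁ a | ‵fromℕ     =
      reach-trans (proj₂ (lift a u)) (_ , step uv (here v))
    ... | ‵inject₁ a | ‵inject₁ b = lift a b

  -- Deleting uv (resp. vw) leaves no arc into (resp. out of) v.
  uv-essential : ¬ Strong (delArc E (ι u) v)
  uv-essential strong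
    with arc-into (proj₂ (strong⇒reach strong (ι u) v)) (λ ιu≡v → v≢ι (sym ιu≡v))
  ... | _ , Epv , not-uv = not-uv (into-v Epv refl , refl)

  vw-essential : ¬ Strong (delArc E v (ι w))
  vw-essential strong with arc-out-of (proj₂ (strong⇒reach strong v (ι w))) v≢ι
  ... | _ , Evq , not-vw = not-vw (refl , out-of-v Evq refl)

  module Bypass (x y : Fin n) where
    E′ : ArcRel (suc n)
    E′ = delArc E (ι x) (ι y)

    D′ : ArcRel n
    D′ = delArc D+ x y

    -- Arcs of D+ − xy become walks of E − ιx ιy; uw becomes u v w.
    lift-arc : ∀ {a c} → D′ a c → Reach E′ (ι a) (ι c)
    lift-arc (inj₁ Aac , not-xy) =
      _ , step (old Aac , λ { (ιa≡ιx , ιc≡ιy) →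
                  not-xy (inject₁-injective ιa≡ιx , inject₁-injective ιc≡ιy) })
                (here _)
    lift-arc (inj₂ (refl , refl) , _) =
      _ , step (uv , λ { (_ , v≡ιy) → v≢ι v≡ιy })
           (step (vw , λ { (v≡ιx , _) → v≢ι v≡ιx }) (here _))

    lift-bypass : Reach D′ x y → Reach E′ (ι x) (ι y)
    lift-bypass (_ , p) = reach-refine ι lift-arc p

    -- Conversely walks of E − ιx ιy between old vertices project to walks
    -- of D+ − xy, replacing each detour u v w by the arc uw; this needs
    -- uw ≠ xy so that the arc uw survives in D+ − xy.
    project : ¬ (u ≡ x × w ≡ y) →
      ∀ {vs s t a b} → Walk E′ vs s t → s ≡ ι a → t ≡ ι b → Reach D′ a b
    project _ (here _) s≡ιa s≡ιb with inject₁-injective (trans (sym s≡ιa) s≡ιb)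
    ... | refl = _ , here _
    project uw≢xy (step (old {c} {d} Acd , not-xy) rest) ιc≡ιa t≡ιb
      with inject₁-injective ιc≡ιa
    ... | refl =
      reach-trans
        (step (inj₁ Acd , λ { (c≡x , d≡y) → not-xy (cong ι c≡x , cong ι d≡y) })
              (here d))
        (project uw≢xy rest refl t≡ιb)
    project _ (step (uv , _) (here _)) _ v≡ιb = ⊥-elim (v≢ι v≡ιb)
    project uw≢xy (step (uv , _) (step (Evq , _) rest)) ιu≡ιa t≡ιb
      with inject₁-injective ιu≡ιa
    ... | refl =
      reach-trans (step (inj₂ (refl , refl) , uw≢xy) (here w))
                  (project uw≢xy rest (out-of-v Evq refl) t≡ιb)
    project _ (step (vw , _) _) v≡ιa _ = ⊥-elim (v≢ι v≡ιa)

    project-bypass : ¬ (u ≡ x × w ≡ y) → Reach E′ (ι x) (ι y) → Reach D′ x y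
    project-bypass uw≢xy (_ , p) = project uw≢xy p refl refl

theorem3p3 : (n : ℕ) (A : ArcRel (suc n)) → MinimalStrong A →
    (u w : Fin (suc n)) → u ≢ w → ¬ A u w →
    MinimalStrong (Expand A u w) ⇔
      (∀ x y → Transitive (addArc A u w) x y → (x ≡ u × y ≡ w))
theorem3p3 n A (loopless , strong , _) u w _ ¬Auw = mk⇔ minimal⇒ ⇒minimal
  where
  open Expansion A u w

  -- A transitive arc xy ≠ uw of D+ lies in D; its bypass lifts to E, so
  -- ιx ιy could be deleted from E.
  minimal⇒ : MinimalStrong E → ∀ x y → Transitive D+ x y → x ≡ u × y ≡ w
  minimal⇒ (_ , strongE , minimalE) x y xy-transitive with proj₁ xy-transitive
  ... | inj₂ xy≡uw = xy≡uw
  ... | inj₁ Axy   = ⊥-elim (minimalE (ι x) (ι y) (old Axy)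
          (bypass⇒strong strongE (lift-bypass (transitive⇒bypass xy-transitive))))
    where open Bypass x y

  -- uv and vw are essential; an arc xy of D with a bypass in E would be
  -- transitive in D+, hence equal to uw, which is not an arc of D.
  ⇒minimal : (∀ x y → Transitive D+ x y → x ≡ u × y ≡ w) → MinimalStrong E
  ⇒minimal onlyUW =
    (λ a Eaa → expand-irreflexive loopless Eaa refl) , expand-strong strong , essential
    where
    essential : ∀ a b → E a b → ¬ Strong (delArc E a b)
    essential _ _ uv = uv-essential
    essential _ _ vw = vw-essential
    essential _ _ (old {x} {y} Axy) strongE′
      with onlyUW x y (bypass⇒transitive (inj₁ Axy) (λ { refl → loopless x Axy })
             (project-bypass (λ { (refl , refl) → ¬Auw Axy })
               (strong⇒reach strongE′ (ι x) (ι y))))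
      where open Bypass x y
    ... | refl , refl = ¬Auw Axy
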